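{- Let $\pi_A,\pi_B$ be $\mathbb{T}$-interpretations (with finite universes $A,B$) over the vocabulary $\tau=\{R\}$ with $R$ a unary relation symbol. If (1) $\pi_A(\neg Ra)=\pi_B(\neg Rb)=\infty$ for all $a\in A$, $b\in B$, (2) $\min_{a\in A}\pi_A(Ra)=\min_{b\in B}\pi_B(Rb)$, and (3) $\sum_{a\in A}\pi_A(Ra)=\sum_{b\in B}\pi_B(Rb)$ (ordinary addition of reals), then $\pi_A\equiv_1\pi_B$.
   Context: The tropical semiring is $\mathbb{T}=(\mathbb{R}_{+}^{\infty},\min,+,\infty,0)$ on the non-negative reals with $\infty$: semiring addition is $\min$, semiring multiplication is ordinary $+$, zero is $\infty$, one is $0$. A $\mathbb{T}$-interpretation with universe $A$ is a map $\pi$ from the literals $Ra,\neg Ra$ ($a\in A$) to $\mathbb{R}_+^\infty$. First-order formulae in negation normal form are evaluated with $\pi[\![a=a]\!]=0$ (the semiring one), $\pi[\![a=b]\!]=\infty$ for $a\ne b$ (dually for $\ne$), literals by $\pi$, $\vee$ and $\exists$ by $\min$, $\wedge$ and $\forall$ by ordinary addition. $\pi_A\equiv_1\pi_B$ means every sentence of quantifier rank at most $1$ has the same value in $\pi_A$ and $\pi_B$. -}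

module Defs where

open import Level using (0ℓ)
open import Data.Nat as ℕ using (ℕ; zero; suc)
open import Data.Fin using (Fin; zero; suc; _≟_)
open import Data.Product using (Σ; ∃; _×_; _,_)
open import Data.Unit using (⊤)
open import Relation.Nullary using (¬_; yes; no)
open import Relation.Binary.PropositionalEquality using (_≡_)
open import Relation.Binary.Definitions using (Decidable)
open import Relation.Binary.Structures using (IsTotalOrder)
open import Algebra.Structures using (IsCommutativeRing)

-- The real numbers, given axiomatically as a (Dedekind-)complete
-- ordered field.  Every model is isomorphic to ℝ, so quantifying over
-- all models is the same as speaking about ℝ.  Order is assumed
-- decidable (classical reals, as in the paper).

record RealModel : Set₁ where
  infixl 6 _+_
  infixl 7 _*_
  infix 4 _≤_
  field
    ℝ   : Set
    _+_ : ℝ → ℝ → ℝ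
    _*_ : ℝ → ℝ → ℝ
    -_  : ℝ → ℝ
    0ℝ  : ℝ
    1ℝ  : ℝ
    _≤_ : ℝ → ℝ → Set
    isCommutativeRing : IsCommutativeRing _≡_ _+_ _*_ -_ 0ℝ 1ℝ
    0≢1     : ¬ (0ℝ ≡ 1ℝ)
    inverse : ∀ x → ¬ (x ≡ 0ℝ) → ∃ λ y → x * y ≡ 1ℝ
    isTotalOrder : IsTotalOrder _≡_ _≤_
    _≤?_    : Decidable _≤_
    +-mono-≤ : ∀ {x y} z → x ≤ y → x + z ≤ y + z
    *-nonneg : ∀ {x y} → 0ℝ ≤ x → 0ℝ ≤ y → 0ℝ ≤ x * y
    complete : (P : ℝ → Set) → ∃ P → (∃ λ u → ∀ x → P x → x ≤ u) →
               ∃ λ s → (∀ x → P x → x ≤ s) ×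
                       (∀ u → (∀ x → P x → x ≤ u) → s ≤ u)

module Tropical (ℛ : RealModel) where
  open RealModel ℛ

  -- ℝ extended by ∞; the carrier of 𝕋 is the nonnegative part.
  data ℝ∞ : Set where
    fin : ℝ → ℝ∞
    ∞   : ℝ∞

  NonNegative : ℝ∞ → Set
  NonNegative (fin x) = 0ℝ ≤ x
  NonNegative ∞       = ⊤

  _⊕_ : ℝ∞ → ℝ∞ → ℝ∞
  ∞ ⊕ y = y
  fin x ⊕ ∞ = fin x
  fin x ⊕ fin y with x ≤? y
  ... | yes _ = fin x
  ... | no  _ = fin y

  _⊗_ : ℝ∞ → ℝ∞ → ℝ∞
  fin x ⊗ fin y = fin (x + y)
  fin x ⊗ ∞ = ∞
  ∞ ⊗ y = ∞

  𝟘 𝟙 : ℝ∞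
  𝟘 = ∞
  𝟙 = fin 0ℝ

  bigMin : ∀ {n} → (Fin n → ℝ∞) → ℝ∞
  bigMin {zero}  f = 𝟘
  bigMin {suc n} f = f zero ⊕ bigMin (λ i → f (suc i))

  bigSum : ∀ {n} → (Fin n → ℝ∞) → ℝ∞
  bigSum {zero}  f = 𝟙
  bigSum {suc n} f = f zero ⊗ bigSum (λ i → f (suc i))

  -- 𝕋-interpretation with universe Fin k:
  -- pos a = π(R a), neg a = π(¬ R a).
  record Interp (k : ℕ) : Set where
    field
      pos : Fin k → ℝ∞
      neg : Fin k → ℝ∞
  open Interp public

  IsTInterp : ∀ {k} → Interp k → Set
  IsTInterp π = ∀ a → NonNegative (pos π a) × NonNegative (neg π a)

-- First-order formulae in negation normal form over τ = {R},
-- with de Bruijn variables (n = number of variables in scope).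
data Formula (n : ℕ) : Set where
  eq neq : Fin n → Fin n → Formula n
  Rel nRel : Fin n → Formula n
  _∧_ _∨_ : Formula n → Formula n → Formula n
  ex all : Formula (suc n) → Formula n

qr : ∀ {n} → Formula n → ℕ
qr (eq _ _)  = 0
qr (neq _ _) = 0
qr (Rel _)   = 0
qr (nRel _)  = 0
qr (φ ∧ ψ)   = qr φ ℕ.⊔ qr ψ
qr (φ ∨ ψ)   = qr φ ℕ.⊔ qr ψ
qr (ex φ)    = suc (qr φ)
qr (all φ)   = suc (qr φ)

Sentence : Set
Sentence = Formula 0

module Semantics (ℛ : RealModel) where
  open RealModel ℛ
  open Tropical ℛ public

  extend : ∀ {m k} → Fin k → (Fin m → Fin k) → Fin (suc m) → Fin k
  extend a ρ zero    = a
  extend a ρ (suc i) = ρ i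

  eval : ∀ {k m} → Interp k → Formula m → (Fin m → Fin k) → ℝ∞
  eval π (eq i j) ρ with ρ i ≟ ρ j
  ... | yes _ = 𝟙
  ... | no  _ = 𝟘
  eval π (neq i j) ρ with ρ i ≟ ρ j
  ... | yes _ = 𝟘
  ... | no  _ = 𝟙
  eval π (Rel i) ρ  = pos π (ρ i)
  eval π (nRel i) ρ = neg π (ρ i)
  eval π (φ ∧ ψ) ρ  = eval π φ ρ ⊗ eval π ψ ρ
  eval π (φ ∨ ψ) ρ  = eval π φ ρ ⊕ eval π ψ ρ
  eval π (ex φ) ρ   = bigMin (λ a → eval π φ (extend a ρ))
  eval π (all φ) ρ  = bigSum (λ a → eval π φ (extend a ρ))

  noVars : ∀ {k} → Fin 0 → Fin k
  noVars ()

  ⟦_⟧_ : ∀ {k} → Sentence → Interp k → ℝ∞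
  ⟦ φ ⟧ π = eval π φ noVars

  Equiv₁ : ∀ {k l} → Interp k → Interp l → Set
  Equiv₁ πA πB = ∀ (φ : Sentence) → qr φ ℕ.≤ 1 → ⟦ φ ⟧ πA ≡ ⟦ φ ⟧ πB

-- Once π(¬Rx) = ∞, a quantifier-free φ(x) evaluates at a to the tropical power π(Ra)^e with an
-- exponent e ∈ ℕ ∪ {∞} depending on φ alone: x = x gives 0, Rx gives 1, x ≠ x and ¬Rx give ∞,
-- ∧ adds exponents and ∨ takes their minimum (here π(Ra) ≥ 0 is needed). Tropical powers are
-- monotone, hence commute with min, and are multiplicative, hence commute with sums, so ∃x φ and
-- ∀x φ evaluate to (min π(R))^e and (Σ π(R))^e. A sentence of rank 1 combines these by ∧ and ∨.
module Submission where

open import Defs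
open import Data.Nat using (suc)
open import Relation.Binary.PropositionalEquality using (_≡_)
open import Data.Nat as ℕ using (ℕ; zero; _⊓_; z≤n; s≤s)
import Data.Nat.Properties as ℕ
open import Data.Fin using (Fin; zero; suc; _≟_)
open import Data.Maybe using (Maybe; just; nothing)
open import Data.Product using (proj₁)
open import Data.Sum as Sum using (_⊎_; inj₁; inj₂)
open import Data.Empty using (⊥-elim)
open import Function using (_∘_)
open import Relation.Nullary using (yes; no)
open import Relation.Binary.PropositionalEquality using (refl; sym; trans; subst; cong; cong₂; module ≡-Reasoning)
open import Algebra.Structures using (IsCommutativeRing)
open import Relation.Binary.Structures using (IsTotalOrder)

module _ (ℛ : RealModel) where
  open RealModel ℛ
  open Semantics ℛ
  private
    module R = IsCommutativeRing isCommutativeRing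
    module O = IsTotalOrder isTotalOrder

  infix 4 _≤∞_
  infixr 30 _^_ _^ᵉ_

  ⊕-identityʳ : ∀ x → x ⊕ ∞ ≡ x
  ⊕-identityʳ (fin x) = refl
  ⊕-identityʳ ∞       = refl

  data _≤∞_ : ℝ∞ → ℝ∞ → Set where
    fin≤fin : ∀ {x y} → x ≤ y → fin x ≤∞ fin y
    ≤-∞     : ∀ {x} → x ≤∞ ∞


  ≤∞-refl : ∀ x → x ≤∞ x
  ≤∞-refl (fin x) = fin≤fin O.refl
  ≤∞-refl ∞       = ≤-∞

  ≤∞-total : ∀ x y → x ≤∞ y ⊎ y ≤∞ x
  ≤∞-total (fin x) (fin y) = Sum.map fin≤fin fin≤fin (O.total x y)
  ≤∞-total x       ∞       = inj₁ ≤-∞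
  ≤∞-total ∞       (fin y) = inj₂ ≤-∞

  nonNegative⇒𝟙≤∞ : ∀ x → NonNegative x → 𝟙 ≤∞ x
  nonNegative⇒𝟙≤∞ (fin x) 0≤x = fin≤fin 0≤x
  nonNegative⇒𝟙≤∞ ∞       _   = ≤-∞

  x≤∞y⇒x⊕y≡x : ∀ {x y} → x ≤∞ y → x ⊕ y ≡ x
  x≤∞y⇒x⊕y≡x {fin x} {fin y} (fin≤fin x≤y) with x ≤? y
  ... | yes _  = refl
  ... | no x≰y = ⊥-elim (x≰y x≤y)
  x≤∞y⇒x⊕y≡x {x} ≤-∞ = ⊕-identityʳ x

  y≤∞x⇒x⊕y≡y : ∀ {x y} → y ≤∞ x → x ⊕ y ≡ y
  y≤∞x⇒x⊕y≡y {fin x} {fin y} (fin≤fin y≤x) with x ≤? y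
  ... | yes x≤y = cong fin (O.antisym x≤y y≤x)
  ... | no _    = refl
  y≤∞x⇒x⊕y≡y ≤-∞ = refl

  ⊗-zeroʳ : ∀ x → x ⊗ ∞ ≡ ∞
  ⊗-zeroʳ (fin x) = refl
  ⊗-zeroʳ ∞       = refl

  ⊗-identityʳ : ∀ x → x ⊗ 𝟙 ≡ x
  ⊗-identityʳ (fin x) = cong fin (R.+-identityʳ x)
  ⊗-identityʳ ∞       = refl

  ⊗-comm : ∀ x y → x ⊗ y ≡ y ⊗ x
  ⊗-comm (fin x) (fin y) = cong fin (R.+-comm x y)
  ⊗-comm (fin x) ∞       = refl
  ⊗-comm ∞       (fin y) = refl
  ⊗-comm ∞       ∞       = refl

  ⊗-assoc : ∀ x y z → (x ⊗ y) ⊗ z ≡ x ⊗ (y ⊗ z)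
  ⊗-assoc (fin x) (fin y) (fin z) = cong fin (R.+-assoc x y z)
  ⊗-assoc (fin x) (fin y) ∞       = refl
  ⊗-assoc (fin x) ∞       _       = refl
  ⊗-assoc ∞       _       _       = refl

  ⊗-identityˡ : ∀ x → 𝟙 ⊗ x ≡ x
  ⊗-identityˡ x = trans (⊗-comm 𝟙 x) (⊗-identityʳ x)

  ⊗-interchange : ∀ w x y z → (w ⊗ x) ⊗ (y ⊗ z) ≡ (w ⊗ y) ⊗ (x ⊗ z)
  ⊗-interchange w x y z = begin
    (w ⊗ x) ⊗ (y ⊗ z)  ≡⟨ ⊗-assoc w x (y ⊗ z) ⟩
    w ⊗ (x ⊗ (y ⊗ z))  ≡⟨ cong (w ⊗_) (sym (⊗-assoc x y z)) ⟩
    w ⊗ ((x ⊗ y) ⊗ z)  ≡⟨ cong (λ u → w ⊗ (u ⊗ z)) (⊗-comm x y) ⟩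
    w ⊗ ((y ⊗ x) ⊗ z)  ≡⟨ cong (w ⊗_) (⊗-assoc y x z) ⟩
    w ⊗ (y ⊗ (x ⊗ z))  ≡⟨ sym (⊗-assoc w y (x ⊗ z)) ⟩
    (w ⊗ y) ⊗ (x ⊗ z)  ∎
    where open ≡-Reasoning

  +-mono-≤ʳ : ∀ x {y z} → y ≤ z → x + y ≤ x + z
  +-mono-≤ʳ x {y} {z} y≤z
    rewrite R.+-comm x y | R.+-comm x z = +-mono-≤ x y≤z

  ⊗-mono-≤∞ : ∀ {w x y z} → w ≤∞ x → y ≤∞ z → w ⊗ y ≤∞ x ⊗ z
  ⊗-mono-≤∞ {y = fin y} {fin z} (fin≤fin {w} {x} w≤x) (fin≤fin y≤z) =
    fin≤fin (O.trans (+-mono-≤ y w≤x) (+-mono-≤ʳ x y≤z))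
  ⊗-mono-≤∞ (fin≤fin _) ≤-∞ = ≤-∞
  ⊗-mono-≤∞ ≤-∞         _   = ≤-∞

  𝟙≤∞-⊗ : ∀ {x y} → 𝟙 ≤∞ x → 𝟙 ≤∞ y → 𝟙 ≤∞ x ⊗ y
  𝟙≤∞-⊗ {x} {y} 𝟙≤x 𝟙≤y =
    subst (_≤∞ x ⊗ y) (⊗-identityʳ 𝟙) (⊗-mono-≤∞ 𝟙≤x 𝟙≤y)

  Monotone : (ℝ∞ → ℝ∞) → Set
  Monotone g = ∀ {x y} → x ≤∞ y → g x ≤∞ g y

  monotone-distrib-⊕ : ∀ {g} → Monotone g → ∀ x y → g (x ⊕ y) ≡ g x ⊕ g y
  monotone-distrib-⊕ {g} g-mono x y with ≤∞-total x y
  ... | inj₁ x≤y = trans (cong g (x≤∞y⇒x⊕y≡x x≤y)) (sym (x≤∞y⇒x⊕y≡x (g-mono x≤y)))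
  ... | inj₂ y≤x = trans (cong g (y≤∞x⇒x⊕y≡y y≤x)) (sym (y≤∞x⇒x⊕y≡y (g-mono y≤x)))

  bigMin-cong : ∀ {k} {f h : Fin k → ℝ∞} → (∀ i → f i ≡ h i) → bigMin f ≡ bigMin h
  bigMin-cong {zero}  _   = refl
  bigMin-cong {suc k} f≗h = cong₂ _⊕_ (f≗h zero) (bigMin-cong (f≗h ∘ suc))

  bigSum-cong : ∀ {k} {f h : Fin k → ℝ∞} → (∀ i → f i ≡ h i) → bigSum f ≡ bigSum h
  bigSum-cong {zero}  _   = refl
  bigSum-cong {suc k} f≗h = cong₂ _⊗_ (f≗h zero) (bigSum-cong (f≗h ∘ suc))

  monotone-distrib-bigMin : ∀ {g} → Monotone g →
                            ∀ {k} (f : Fin (suc k) → ℝ∞) → bigMin (g ∘ f) ≡ g (bigMin f)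
  monotone-distrib-bigMin {g} _ {zero} f =
    trans (⊕-identityʳ (g (f zero))) (cong g (sym (⊕-identityʳ (f zero))))
  monotone-distrib-bigMin {g} g-mono {suc k} f =
    trans (cong (g (f zero) ⊕_) (monotone-distrib-bigMin g-mono (f ∘ suc)))
          (sym (monotone-distrib-⊕ g-mono (f zero) _))

  homomorphism-distrib-bigSum : ∀ {g : ℝ∞ → ℝ∞} → g 𝟙 ≡ 𝟙 → (∀ x y → g (x ⊗ y) ≡ g x ⊗ g y) →
                                ∀ {k} (f : Fin k → ℝ∞) → bigSum (g ∘ f) ≡ g (bigSum f)
  homomorphism-distrib-bigSum g𝟙 _ {zero} f = sym g𝟙
  homomorphism-distrib-bigSum {g} g𝟙 g-⊗ {suc k} f =
    trans (cong (g (f zero) ⊗_) (homomorphism-distrib-bigSum g𝟙 g-⊗ (f ∘ suc)))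
          (sym (g-⊗ (f zero) _))

  _^_ : ℝ∞ → ℕ → ℝ∞
  x ^ zero  = 𝟙
  x ^ suc n = x ⊗ x ^ n

  ^-distribˡ-+-⊗ : ∀ x m n → x ^ (m ℕ.+ n) ≡ x ^ m ⊗ x ^ n
  ^-distribˡ-+-⊗ x zero    n = sym (⊗-identityˡ (x ^ n))
  ^-distribˡ-+-⊗ x (suc m) n =
    trans (cong (x ⊗_) (^-distribˡ-+-⊗ x m n)) (sym (⊗-assoc x (x ^ m) (x ^ n)))

  ^-distribʳ-⊗ : ∀ n x y → (x ⊗ y) ^ n ≡ x ^ n ⊗ y ^ n
  ^-distribʳ-⊗ zero    x y = sym (⊗-identityʳ 𝟙)
  ^-distribʳ-⊗ (suc n) x y =
    trans (cong ((x ⊗ y) ⊗_) (^-distribʳ-⊗ n x y)) (⊗-interchange x y (x ^ n) (y ^ n))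

  𝟙^n≡𝟙 : ∀ n → 𝟙 ^ n ≡ 𝟙
  𝟙^n≡𝟙 zero    = refl
  𝟙^n≡𝟙 (suc n) = trans (⊗-identityˡ (𝟙 ^ n)) (𝟙^n≡𝟙 n)

  ^-monoˡ-≤∞ : ∀ n → Monotone (_^ n)
  ^-monoˡ-≤∞ zero    _   = ≤∞-refl 𝟙
  ^-monoˡ-≤∞ (suc n) x≤y = ⊗-mono-≤∞ x≤y (^-monoˡ-≤∞ n x≤y)

  𝟙≤∞-^ : ∀ {x} n → 𝟙 ≤∞ x → 𝟙 ≤∞ x ^ n
  𝟙≤∞-^ zero    _   = ≤∞-refl 𝟙
  𝟙≤∞-^ (suc n) 𝟙≤x = 𝟙≤∞-⊗ 𝟙≤x (𝟙≤∞-^ n 𝟙≤x)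

  ^-monoʳ-≤ : ∀ {x} → 𝟙 ≤∞ x → ∀ {m n} → m ℕ.≤ n → x ^ m ≤∞ x ^ n
  ^-monoʳ-≤ 𝟙≤x (z≤n {n}) = 𝟙≤∞-^ n 𝟙≤x
  ^-monoʳ-≤ {x} 𝟙≤x (s≤s m≤n) = ⊗-mono-≤∞ (≤∞-refl x) (^-monoʳ-≤ 𝟙≤x m≤n)

  ^-distribˡ-⊓-⊕ : ∀ {x} → 𝟙 ≤∞ x → ∀ m n → x ^ (m ⊓ n) ≡ x ^ m ⊕ x ^ n
  ^-distribˡ-⊓-⊕ {x} 𝟙≤x m n with ℕ.≤-total m n
  ... | inj₁ m≤n = trans (cong (x ^_) (ℕ.m≤n⇒m⊓n≡m m≤n))
                         (sym (x≤∞y⇒x⊕y≡x (^-monoʳ-≤ 𝟙≤x m≤n)))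
  ... | inj₂ n≤m = trans (cong (x ^_) (ℕ.m≥n⇒m⊓n≡n n≤m))
                         (sym (y≤∞x⇒x⊕y≡y (^-monoʳ-≤ 𝟙≤x n≤m)))

  -- Exponents in ℕ ∪ {∞}, with nothing playing ∞ and x ^ᵉ ∞ = ∞ (also for x = 𝟙).
  _^ᵉ_ : ℝ∞ → Maybe ℕ → ℝ∞
  x ^ᵉ just n  = x ^ n
  x ^ᵉ nothing = ∞

  _+ᵉ_ : Maybe ℕ → Maybe ℕ → Maybe ℕ
  just m +ᵉ just n = just (m ℕ.+ n)
  _      +ᵉ _      = nothing

  _⊓ᵉ_ : Maybe ℕ → Maybe ℕ → Maybe ℕ
  just m  ⊓ᵉ just n  = just (m ⊓ n)
  just m  ⊓ᵉ nothing = just m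
  nothing ⊓ᵉ e       = e

  ^ᵉ-distribˡ-+ᵉ-⊗ : ∀ x d e → x ^ᵉ (d +ᵉ e) ≡ x ^ᵉ d ⊗ x ^ᵉ e
  ^ᵉ-distribˡ-+ᵉ-⊗ x (just m) (just n) = ^-distribˡ-+-⊗ x m n
  ^ᵉ-distribˡ-+ᵉ-⊗ x (just m) nothing  = sym (⊗-zeroʳ (x ^ m))
  ^ᵉ-distribˡ-+ᵉ-⊗ x nothing  _        = refl

  ^ᵉ-distribˡ-⊓ᵉ-⊕ : ∀ {x} → 𝟙 ≤∞ x → ∀ d e → x ^ᵉ (d ⊓ᵉ e) ≡ x ^ᵉ d ⊕ x ^ᵉ e
  ^ᵉ-distribˡ-⊓ᵉ-⊕ 𝟙≤x (just m) (just n) = ^-distribˡ-⊓-⊕ 𝟙≤x m n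
  ^ᵉ-distribˡ-⊓ᵉ-⊕ {x} _ (just m) nothing = sym (⊕-identityʳ (x ^ m))
  ^ᵉ-distribˡ-⊓ᵉ-⊕ _ nothing _ = refl

  ^ᵉ-monoˡ-≤∞ : ∀ e → Monotone (_^ᵉ e)
  ^ᵉ-monoˡ-≤∞ (just n) = ^-monoˡ-≤∞ n
  ^ᵉ-monoˡ-≤∞ nothing  = λ _ → ≤-∞

  bigMin-^ᵉ : ∀ {k} (f : Fin (suc k) → ℝ∞) e → bigMin (λ i → f i ^ᵉ e) ≡ bigMin f ^ᵉ e
  bigMin-^ᵉ f e = monotone-distrib-bigMin (^ᵉ-monoˡ-≤∞ e) f

  bigSum-^ᵉ : ∀ {k} (f : Fin (suc k) → ℝ∞) e → bigSum (λ i → f i ^ᵉ e) ≡ bigSum f ^ᵉ e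
  bigSum-^ᵉ f (just n) = homomorphism-distrib-bigSum (𝟙^n≡𝟙 n) (λ x y → ^-distribʳ-⊗ n x y) f
  bigSum-^ᵉ f nothing  = refl

  exponent : Formula 1 → Maybe ℕ
  exponent (eq _ _)  = just 0
  exponent (neq _ _) = nothing
  exponent (Rel _)   = just 1
  exponent (nRel _)  = nothing
  exponent (φ ∧ ψ)   = exponent φ +ᵉ exponent ψ
  exponent (φ ∨ ψ)   = exponent φ ⊓ᵉ exponent ψ
  exponent (ex _)    = nothing
  exponent (all _)   = nothing

  module _ {k} (π : Interp (suc k)) (neg≡∞ : ∀ a → neg π a ≡ ∞)
           (𝟙≤pos : ∀ a → 𝟙 ≤∞ pos π a) where

    eval-exponent : ∀ (φ : Formula 1) → qr φ ℕ.≤ 0 → ∀ a →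
                    eval π φ (extend a noVars) ≡ pos π a ^ᵉ exponent φ
    eval-exponent (eq zero zero) _ a with a ≟ a
    ... | yes _  = refl
    ... | no a≢a = ⊥-elim (a≢a refl)
    eval-exponent (neq zero zero) _ a with a ≟ a
    ... | yes _  = refl
    ... | no a≢a = ⊥-elim (a≢a refl)
    eval-exponent (Rel zero)  _ a = sym (⊗-identityʳ (pos π a))
    eval-exponent (nRel zero) _ a = neg≡∞ a
    eval-exponent (φ ∧ ψ) qr≤0 a =
      trans (cong₂ _⊗_ (eval-exponent φ (ℕ.m⊔n≤o⇒m≤o (qr φ) (qr ψ) qr≤0) a)
                       (eval-exponent ψ (ℕ.m⊔n≤o⇒n≤o (qr φ) (qr ψ) qr≤0) a))
            (sym (^ᵉ-distribˡ-+ᵉ-⊗ (pos π a) (exponent φ) (exponent ψ)))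
    eval-exponent (φ ∨ ψ) qr≤0 a =
      trans (cong₂ _⊕_ (eval-exponent φ (ℕ.m⊔n≤o⇒m≤o (qr φ) (qr ψ) qr≤0) a)
                       (eval-exponent ψ (ℕ.m⊔n≤o⇒n≤o (qr φ) (qr ψ) qr≤0) a))
            (sym (^ᵉ-distribˡ-⊓ᵉ-⊕ (𝟙≤pos a) (exponent φ) (exponent ψ)))

    ⟦ex⟧-exponent : ∀ (φ : Formula 1) → qr φ ℕ.≤ 0 →
                    ⟦ ex φ ⟧ π ≡ bigMin (pos π) ^ᵉ exponent φ
    ⟦ex⟧-exponent φ qr≤0 =
      trans (bigMin-cong (eval-exponent φ qr≤0)) (bigMin-^ᵉ (pos π) (exponent φ))

    ⟦all⟧-exponent : ∀ (φ : Formula 1) → qr φ ℕ.≤ 0 →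
                     ⟦ all φ ⟧ π ≡ bigSum (pos π) ^ᵉ exponent φ
    ⟦all⟧-exponent φ qr≤0 =
      trans (bigSum-cong (eval-exponent φ qr≤0)) (bigSum-^ᵉ (pos π) (exponent φ))

  ≡₁-by-min-and-sum :
    ∀ {kA kB} (πA : Interp (suc kA)) (πB : Interp (suc kB)) →
    (∀ a → neg πA a ≡ ∞) → (∀ b → neg πB b ≡ ∞) →
    (∀ a → 𝟙 ≤∞ pos πA a) → (∀ b → 𝟙 ≤∞ pos πB b) →
    bigMin (pos πA) ≡ bigMin (pos πB) → bigSum (pos πA) ≡ bigSum (pos πB) →
    Equiv₁ πA πB
  ≡₁-by-min-and-sum πA πB negA negB posA posB min≡ sum≡ = go
    where
    go : ∀ (φ : Sentence) → qr φ ℕ.≤ 1 → ⟦ φ ⟧ πA ≡ ⟦ φ ⟧ πB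
    go (eq () _)
    go (neq () _)
    go (Rel ())
    go (nRel ())
    go (φ ∧ ψ) qr≤1 = cong₂ _⊗_ (go φ (ℕ.m⊔n≤o⇒m≤o (qr φ) (qr ψ) qr≤1))
                                (go ψ (ℕ.m⊔n≤o⇒n≤o (qr φ) (qr ψ) qr≤1))
    go (φ ∨ ψ) qr≤1 = cong₂ _⊕_ (go φ (ℕ.m⊔n≤o⇒m≤o (qr φ) (qr ψ) qr≤1))
                                (go ψ (ℕ.m⊔n≤o⇒n≤o (qr φ) (qr ψ) qr≤1))
    go (ex φ) (s≤s qr≤0) =
      trans (⟦ex⟧-exponent πA negA posA φ qr≤0)
            (trans (cong (_^ᵉ exponent φ) min≡) (sym (⟦ex⟧-exponent πB negB posB φ qr≤0)))
    go (all φ) (s≤s qr≤0) =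
      trans (⟦all⟧-exponent πA negA posA φ qr≤0)
            (trans (cong (_^ᵉ exponent φ) sum≡) (sym (⟦all⟧-exponent πB negB posB φ qr≤0)))

proposition3p8 : (ℛ : RealModel) → let open Semantics ℛ in
    ∀ {kA kB} (πA : Interp (suc kA)) (πB : Interp (suc kB)) →
    IsTInterp πA → IsTInterp πB →
    (∀ a → neg πA a ≡ ∞) → (∀ b → neg πB b ≡ ∞) →
    bigMin (pos πA) ≡ bigMin (pos πB) →
    bigSum (pos πA) ≡ bigSum (pos πB) →
    Equiv₁ πA πB
proposition3p8 ℛ πA πB tA tB negA negB =
  ≡₁-by-min-and-sum ℛ πA πB negA negB
    (λ a → nonNegative⇒𝟙≤∞ ℛ (pos πA a) (proj₁ (tA a)))
    (λ b → nonNegative⇒𝟙≤∞ ℛ (pos πB b) (proj₁ (tB b)))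
  where open Semantics ℛ using (pos)
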